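{- For every sentence $\varphi$ over the vocabulary $\{\sim\}$ with pattern $E_1^{\ge}ae$ (i.e. of the form $\exists^{\ge}S\,\forall x\,\exists y\,\chi$ with $\chi$ quantifier-free) there is a binary pattern graph $P$ such that, for every basic graph $B$ with at least two vertices and every $k\in\mathbb N$, $(B,k)\models\varphi$ if and only if $(B,k)\in\mathrm{p\text{ - }saturation}^{\ge}(P)$.
   Context: A basic graph $B=(V,E)$ is a finite undirected graph without self-loops, viewed as a structure over $\{\sim\}$. $(B,k)\models\exists^{\ge}S\,\psi(S)$ iff there is $C\subseteq V$, $|C|\ge k$, with $B\models\psi(C)$ ($S$ a unary second-order variable). A binary pattern graph is $P=(C,A^\oplus,A^\ominus)$ with $C=\{\mathrm{black},\mathrm{white}\}$ and $A^\oplus,A^\ominus\subseteq C\times C$ (not necessarily disjoint). For a coloring $c\colon V\to C$, a witness function is $w\colon V\to V$ such that for all $x\in V$: $x\neq w(x)$; if $\{x,w(x)\}\in E$ then $(c(x),c(w(x)))\in A^\oplus$; if $\{x,w(x)\}\notin E$ then $(c(x),c(w(x)))\in A^\ominus$. $B$ is $P$-saturated by $c$ and $w$ if $w$ is a witness function for $c$. The weight of $c$ is the number of black vertices. $\mathrm{p\text{ - }saturation}^{\ge}(P)$: Instance: a basic graph $B$ and $k\in\mathbb N$; parameter $k$; Question: can $B$ be $P$-saturated via a coloring of weight at least $k$? -}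

module Defs where

open import Data.Nat using (ℕ; _≤_)
open import Data.Bool using (Bool; true; false; not; _∧_; _∨_; T)
open import Data.Fin using (Fin; _≟_)
open import Data.Fin.Subset using (Subset; ∣_∣)
open import Data.Vec using (lookup; tabulate)
open import Data.Product using (Σ; _×_)
open import Relation.Nullary using (¬_)
open import Relation.Nullary.Decidable using (⌊_⌋)
open import Relation.Binary.PropositionalEquality using (_≡_)

record BasicGraph (n : ℕ) : Set where
  field
    adj   : Fin n → Fin n → Bool
    sym   : ∀ u v → adj u v ≡ adj v u
    irrefl : ∀ v → adj v v ≡ false

open BasicGraph public

-- Quantifier-free formulas χ over {∼} with the first-order variables
-- x, y and the unary second-order variable S (equality is allowed).

data Var : Set where
  vx vy : Var

data QF : Set where
  ⊤f ⊥f : QF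
  adjA  : Var → Var → QF
  eqA   : Var → Var → QF
  memA  : Var → QF
  negF  : QF → QF
  andF  : QF → QF → QF
  orF   : QF → QF → QF

evalQF : ∀ {n} → BasicGraph n → Subset n → Fin n → Fin n → QF → Bool
evalQF {n} B C a b = go
  where
  val : Var → Fin n
  val vx = a
  val vy = b
  go : QF → Bool
  go ⊤f = true
  go ⊥f = false
  go (adjA u v) = adj B (val u) (val v)
  go (eqA u v) = ⌊ val u ≟ val v ⌋
  go (memA u) = lookup C (val u)
  go (negF φ) = not (go φ)
  go (andF φ ψ) = go φ ∧ go ψ
  go (orF φ ψ) = go φ ∨ go ψ

Models-E1ae : ∀ {n} → QF → BasicGraph n → ℕ → Set
Models-E1ae {n} χ B k =
  Σ (Subset n) λ C → (k ≤ ∣ C ∣) × ((a : Fin n) → Σ (Fin n) λ b → T (evalQF B C a b χ))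

data Color : Set where
  black white : Color

isBlack : Color → Bool
isBlack black = true
isBlack white = false

record PatternGraph : Set where
  field
    A⊕ : Color → Color → Bool
    A⊖ : Color → Color → Bool

open PatternGraph public

Coloring : ℕ → Set
Coloring n = Fin n → Color

weight : ∀ {n} → Coloring n → ℕ
weight c = ∣ tabulate (λ v → isBlack (c v)) ∣

IsWitness : ∀ {n} → PatternGraph → BasicGraph n → Coloring n → (Fin n → Fin n) → Set
IsWitness {n} P B c w = (x : Fin n) →
    (¬ (x ≡ w x))
  × (T (adj B x (w x)) → T (A⊕ P (c x) (c (w x))))
  × (T (not (adj B x (w x))) → T (A⊖ P (c x) (c (w x))))

Saturated : ∀ {n} → PatternGraph → BasicGraph n → Coloring n → (Fin n → Fin n) → Set
Saturated = IsWitness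

InPSaturation≥ : PatternGraph → ∀ {n} → BasicGraph n → ℕ → Set
InPSaturation≥ P {n} B k =
  Σ (Coloring n) λ c → (k ≤ weight c) × Σ (Fin n → Fin n) λ w → Saturated P B c w

-- Whether χ(x, y) holds depends only on the atomic type of the pair: the
-- colours of x and y, whether x ∼ y, and whether x = y.  For x ≠ y this is
-- exactly what A⊕ and A⊖ can record.  The diagonal case y = x is folded into
-- the pattern: if χ(x, x) holds for the colour of x, every pair starting
-- with that colour is allowed, and the witness is any vertex other than x,
-- which exists because B has at least two vertices.
module Submission where

open import Defs
open import Data.Bool using (Bool; true; false; not; _∧_; _∨_; T)
open import Data.Bool.Properties using (T-∨)
open import Data.Fin using (Fin; zero; suc; _≟_)
open import Data.Fin.Subset using (Subset; ∣_∣)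
open import Data.Nat using (ℕ; _≥_; _≤_; s≤s; z≤n)
open import Data.Product using (Σ; _×_; _,_; proj₁; proj₂)
open import Data.Sum using (inj₁; inj₂)
open import Data.Vec using (lookup; tabulate)
open import Data.Vec.Properties using (lookup∘tabulate; tabulate∘lookup; tabulate-cong)
open import Function using (_∘_)
open import Function.Bundles using (_⇔_; mk⇔; Equivalence)
open import Relation.Nullary using (yes; no; contradiction)
open import Relation.Nullary.Decidable using (⌊_⌋)
open import Relation.Binary.PropositionalEquality
  using (_≡_; _≢_; refl; trans; cong; cong₂; subst; ≡-≟-identity; ≢-≟-identity)
  renaming (sym to ≡-sym)

evalType : (Sx Sy x∼y x≡y : Bool) → QF → Bool
evalType Sx Sy x∼y x≡y = go
  where
  go : QF → Bool
  go ⊤f = true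
  go ⊥f = false
  go (adjA vx vx) = false
  go (adjA vx vy) = x∼y
  go (adjA vy vx) = x∼y
  go (adjA vy vy) = false
  go (eqA vx vx) = true
  go (eqA vx vy) = x≡y
  go (eqA vy vx) = x≡y
  go (eqA vy vy) = true
  go (memA vx) = Sx
  go (memA vy) = Sy
  go (negF φ) = not (go φ)
  go (andF φ ψ) = go φ ∧ go ψ
  go (orF φ ψ) = go φ ∨ go ψ

≟-swap : ∀ {n} (a b : Fin n) → ⌊ b ≟ a ⌋ ≡ ⌊ a ≟ b ⌋
≟-swap a b with a ≟ b | b ≟ a
... | yes _   | yes _   = refl
... | no _    | no _    = refl
... | yes a≡b | no b≢a  = contradiction (≡-sym a≡b) b≢a
... | no a≢b  | yes b≡a = contradiction (≡-sym b≡a) a≢b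

≟-refl : ∀ {n} (a : Fin n) → ⌊ a ≟ a ⌋ ≡ true
≟-refl a = cong ⌊_⌋ (≡-≟-identity _≟_ {a} refl)

evalQF≡evalType : ∀ {n} (B : BasicGraph n) (C : Subset n) (a b : Fin n) (χ : QF) →
  evalQF B C a b χ ≡ evalType (lookup C a) (lookup C b) (adj B a b) ⌊ a ≟ b ⌋ χ
evalQF≡evalType B C a b ⊤f = refl
evalQF≡evalType B C a b ⊥f = refl
evalQF≡evalType B C a b (adjA vx vx) = irrefl B a
evalQF≡evalType B C a b (adjA vx vy) = refl
evalQF≡evalType B C a b (adjA vy vx) = BasicGraph.sym B b a
evalQF≡evalType B C a b (adjA vy vy) = irrefl B b
evalQF≡evalType B C a b (eqA vx vx) = ≟-refl a
evalQF≡evalType B C a b (eqA vx vy) = refl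
evalQF≡evalType B C a b (eqA vy vx) = ≟-swap a b
evalQF≡evalType B C a b (eqA vy vy) = ≟-refl b
evalQF≡evalType B C a b (memA vx) = refl
evalQF≡evalType B C a b (memA vy) = refl
evalQF≡evalType B C a b (negF φ) = cong not (evalQF≡evalType B C a b φ)
evalQF≡evalType B C a b (andF φ ψ) =
  cong₂ _∧_ (evalQF≡evalType B C a b φ) (evalQF≡evalType B C a b ψ)
evalQF≡evalType B C a b (orF φ ψ) =
  cong₂ _∨_ (evalQF≡evalType B C a b φ) (evalQF≡evalType B C a b ψ)

colorOf : Bool → Color
colorOf true = black
colorOf false = white

isBlack∘colorOf : ∀ b → isBlack (colorOf b) ≡ b
isBlack∘colorOf true = refl
isBlack∘colorOf false = refl

blackSet : ∀ {n} → Coloring n → Subset n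
blackSet c = tabulate (isBlack ∘ c)

blackSet∘colorOf : ∀ {n} (C : Subset n) → blackSet (colorOf ∘ lookup C) ≡ C
blackSet∘colorOf C = trans (tabulate-cong (isBlack∘colorOf ∘ lookup C)) (tabulate∘lookup C)

module _ {n : ℕ} (B : BasicGraph n) (c : Coloring n) (χ : QF) where

  evalQF-distinct : ∀ {a b} → a ≢ b →
    evalQF B (blackSet c) a b χ ≡ evalType (isBlack (c a)) (isBlack (c b)) (adj B a b) false χ
  evalQF-distinct {a} {b} a≢b
    rewrite evalQF≡evalType B (blackSet c) a b χ
          | lookup∘tabulate (isBlack ∘ c) a
          | lookup∘tabulate (isBlack ∘ c) b
          | ≢-≟-identity _≟_ a≢b = refl

  evalQF-diagonal : ∀ a →
    evalQF B (blackSet c) a a χ ≡ evalType (isBlack (c a)) (isBlack (c a)) false true χ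
  evalQF-diagonal a
    rewrite evalQF≡evalType B (blackSet c) a a χ
          | lookup∘tabulate (isBlack ∘ c) a
          | irrefl B a
          | ≟-refl a = refl

module _ (χ : QF) where

  holdsOffDiagonal : (x∼y : Bool) → Color → Color → Bool
  holdsOffDiagonal x∼y cx cy = evalType (isBlack cx) (isBlack cy) x∼y false χ

  holdsOnDiagonal : Color → Bool
  holdsOnDiagonal cx = evalType (isBlack cx) (isBlack cx) false true χ

  allowed : (x∼y : Bool) → Color → Color → Bool
  allowed x∼y cx cy = holdsOffDiagonal x∼y cx cy ∨ holdsOnDiagonal cx

patternOf : QF → PatternGraph
patternOf χ = record { A⊕ = allowed χ true ; A⊖ = allowed χ false }

WitnessAt : ∀ {n} → PatternGraph → BasicGraph n → Coloring n → Fin n → Fin n → Set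
WitnessAt P B c x y =
    (x ≢ y)
  × (T (adj B x y) → T (A⊕ P (c x) (c y)))
  × (T (not (adj B x y)) → T (A⊖ P (c x) (c y)))

ForallExists : ∀ {n} → QF → BasicGraph n → Subset n → Set
ForallExists {n} χ B C = (a : Fin n) → Σ (Fin n) λ b → T (evalQF B C a b χ)

T-cases⇔ : (Q : Bool → Set) (e : Bool) → Q e ⇔ ((T e → Q true) × (T (not e) → Q false))
T-cases⇔ Q true  = mk⇔ (λ q → (λ _ → q) , λ ()) (λ (q , _) → q _)
T-cases⇔ Q false = mk⇔ (λ q → (λ ()) , λ _ → q) (λ (_ , q) → q _)

anotherVertex : ∀ {n} → n ≥ 2 → (a : Fin n) → Σ (Fin n) (a ≢_)
anotherVertex (s≤s (s≤s z≤n)) zero    = suc zero , λ ()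
anotherVertex (s≤s (s≤s z≤n)) (suc _) = zero , λ ()

module _ {n : ℕ} (B : BasicGraph n) (c : Coloring n) (χ : QF) where

  witnessConditions⇔allowed : ∀ a b →
    T (allowed χ (adj B a b) (c a) (c b))
      ⇔ ((T (adj B a b) → T (allowed χ true (c a) (c b)))
        × (T (not (adj B a b)) → T (allowed χ false (c a) (c b))))
  witnessConditions⇔allowed a b = T-cases⇔ (λ e → T (allowed χ e (c a) (c b))) (adj B a b)

  witness-from-solution : n ≥ 2 → ∀ a b → T (evalQF B (blackSet c) a b χ) →
    Σ (Fin n) (WitnessAt (patternOf χ) B c a)
  witness-from-solution n≥2 a b χab with a ≟ b
  ... | yes refl =
    let (a′ , a≢a′) = anotherVertex n≥2 a
    in a′ , a≢a′ , Equivalence.to (witnessConditions⇔allowed a a′)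
                     (Equivalence.from T-∨ (inj₂ (subst T (evalQF-diagonal B c χ a) χab)))
  ... | no a≢b =
    b , a≢b , Equivalence.to (witnessConditions⇔allowed a b)
                (Equivalence.from T-∨ (inj₁ (subst T (evalQF-distinct B c χ a≢b) χab)))

  solution-from-witness : ∀ a b → WitnessAt (patternOf χ) B c a b →
    Σ (Fin n) λ b′ → T (evalQF B (blackSet c) a b′ χ)
  solution-from-witness a b (a≢b , conditions)
    with Equivalence.to T-∨ (Equivalence.from (witnessConditions⇔allowed a b) conditions)
  ... | inj₁ offDiagonal = b , subst T (≡-sym (evalQF-distinct B c χ a≢b)) offDiagonal
  ... | inj₂ onDiagonal  = a , subst T (≡-sym (evalQF-diagonal B c χ a)) onDiagonal

  forallExists⇔saturated : n ≥ 2 →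
    ForallExists χ B (blackSet c) ⇔ Σ (Fin n → Fin n) (Saturated (patternOf χ) B c)
  forallExists⇔saturated n≥2 = mk⇔
    (λ solutions → let witness a = witness-from-solution n≥2 a (proj₁ (solutions a)) (proj₂ (solutions a))
                   in proj₁ ∘ witness , proj₂ ∘ witness)
    (λ (w , saturated) a → solution-from-witness a (w a) (saturated a))

mainTheorem14 : (χ : QF) → Σ PatternGraph λ P →
    (n : ℕ) → n ≥ 2 → (B : BasicGraph n) → (k : ℕ) →
    Models-E1ae χ B k ⇔ InPSaturation≥ P B k
mainTheorem14 χ = patternOf χ , λ n n≥2 B k → mk⇔
  (λ (C , k≤∣C∣ , solutions) →
    let c = colorOf ∘ lookup C
        C≡blackSet = ≡-sym (blackSet∘colorOf C)
    in c , subst (λ D → k ≤ ∣ D ∣) C≡blackSet k≤∣C∣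
         , Equivalence.to (forallExists⇔saturated B c χ n≥2)
             (subst (ForallExists χ B) C≡blackSet solutions))
  (λ (c , k≤weight , saturation) →
    blackSet c , k≤weight , Equivalence.from (forallExists⇔saturated B c χ n≥2) saturation)
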